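{- Let $a,b$ be coprime positive integers with $a>b\geqslant 1$ and let $\beta=a/b$. For every integer $d$ with $b\leqslant d\leqslant a-1$, parallel addition in base $\beta$ is possible on the alphabet $\mathcal{A}_{ -d}=\{ -d,\ldots,0,\ldots,a+b-d-1\}$ (of cardinality $a+b$).
   Context: For a complex number $\beta$ with $|\beta|>1$ and a finite set $\mathcal{A}\subset\mathbb{C}$ containing $0$, let $\mathrm{Fin}_{\mathcal{A}}(\beta)=\{\sum_{j\in I}x_j\beta^j : I\subset\mathbb{Z}\text{ finite},\ x_j\in\mathcal{A}\}$. For finite alphabets $\mathcal{A},\mathcal{B}$, a map $\varphi:\mathcal{A}^{\mathbb{Z}}\to\mathcal{B}^{\mathbb{Z}}$ is $p$-local if there are integers $r,t\geqslant 0$ with $p=r+t+1$ and a map $\Phi:\mathcal{A}^p\to\mathcal{B}$ such that for every $u=(u_j)$ and $v=\varphi(u)$ one has $v_j=\Phi(u_{j+t}\cdots u_j\cdots u_{j-r})$ for all $j\in\mathbb{Z}$. A digit set conversion in base $\beta$ from $\mathcal{A}$ to $\mathcal{B}$ (both containing $0$) is a map $\varphi:\mathcal{A}^{\mathbb{Z}}\to\mathcal{B}^{\mathbb{Z}}$ such that whenever $u$ has finitely many nonzero entries, $v=\varphi(u)$ has finitely many nonzero entries and $\sum_j v_j\beta^j=\sum_j u_j\beta^j$. Parallel addition in base $\beta$ is possible on $\mathcal{A}$ if there is a digit set conversion in base $\beta$ from $\mathcal{A}+\mathcal{A}=\{x+y:x,y\in\mathcal{A}\}$ to $\mathcal{A}$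 that is $p$-local for some $p$. -}

module Defs where

open import Data.Nat as ℕ using (ℕ; zero; suc)
open import Data.Integer as ℤ using (ℤ; +_; -[1+_]; ∣_∣)
open import Data.Rational as ℚ using (ℚ; 0ℚ; 1ℚ)
open import Data.Fin using (Fin; toℕ)
open import Data.List using (List; map; upTo; foldr)
open import Data.Product using (Σ; ∃; _×_; _,_; proj₁)
open import Relation.Binary.PropositionalEquality using (_≡_)

Alphabet : Set₁
Alphabet = ℤ → Set

Digit : Alphabet → Set
Digit A = Σ ℤ A

Seq : Alphabet → Set
Seq A = ℤ → Digit A

AlphInt : (a b d : ℕ) → Alphabet
AlphInt a b d x = (ℤ.- (+ d)) ℤ.≤ x × x ℤ.≤ (+ (a ℕ.+ b) ℤ.- + d ℤ.- + 1)

SumSet : Alphabet → Alphabet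
SumSet A z = Σ ℤ λ x → Σ ℤ λ y → A x × A y × z ≡ x ℤ.+ y

qpow : ℚ → ℕ → ℚ
qpow q zero = 1ℚ
qpow q (suc n) = q ℚ.* qpow q n

-- (a/b)^j for j ∈ ℤ; junk value 0 when a = 0 or b = 0 (never used).
βpow : (a b : ℕ) → ℤ → ℚ
βpow a zero j = 0ℚ
βpow zero (suc b) j = 0ℚ
βpow (suc a) (suc b) (+ n) = qpow ((+ suc a) ℚ./ suc b) n
βpow (suc a) (suc b) -[1+ n ] = qpow ((+ suc b) ℚ./ suc a) (suc n)

SupportedIn : {A : Alphabet} → Seq A → ℕ → Set
SupportedIn u N = ∀ j → N ℕ.< ∣ j ∣ → proj₁ (u j) ≡ + 0

window : ℕ → List ℤ
window N = map (λ k → (+ k) ℤ.- (+ N)) (upTo (suc (2 ℕ.* N)))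

value : (a b : ℕ) {A : Alphabet} → Seq A → ℕ → ℚ
value a b u N = foldr ℚ._+_ 0ℚ (map (λ j → ℚ._/_ (proj₁ (u j)) 1 ℚ.* βpow a b j) (window N))

-- φ is p-local: there are r, t ≥ 0 with p = r + t + 1 and Φ : A^p → B with
-- v_j = Φ(u_{j+t} ⋯ u_j ⋯ u_{j-r}); position i of the window is u_{j+t-i}.
IsLocal : {A B : Alphabet} → (Seq A → Seq B) → ℕ → Set
IsLocal {A} {B} φ p =
  Σ ℕ λ r → Σ ℕ λ t → (r ℕ.+ t ℕ.+ 1 ≡ p) ×
  Σ ((Fin p → Digit A) → Digit B) λ Φ →
    ∀ (u : Seq A) (j : ℤ) →
      proj₁ (φ u j) ≡ proj₁ (Φ (λ i → u (j ℤ.+ + t ℤ.- + toℕ i)))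

IsDigitSetConversion : (a b : ℕ) {A B : Alphabet} → (Seq A → Seq B) → Set
IsDigitSetConversion a b φ =
  ∀ u N → SupportedIn u N →
    Σ ℕ λ M → SupportedIn (φ u) M × value a b (φ u) M ≡ value a b u N

ParallelAddition : (a b : ℕ) → Alphabet → Set
ParallelAddition a b A =
  Σ (Seq (SumSet A) → Seq A) λ φ →
    IsDigitSetConversion a b φ × Σ ℕ λ p → IsLocal φ p

module Submission where

-- An input z_j ∈ A + A is rewritten as v_j = z_j + b·c_(j−1) − a·c_j; since
-- b·β^j = a·β^(j−1) the carries telescope away, so v has the value of z whenever the
-- carries vanish far out.  The carry is computed from the k previous inputs only:
--     c_j = ⌊(Σ_(i<k) a^(k−1−i) b^i z_(j−i) + K) / a^k⌋ ,
-- which makes v_j a function of z_j, …, z_(j−k), i.e. (k+1)-local.  Writing both carries with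
-- their remainders r₀, r₁ ∈ [0, a^k) gives the exact identity
--     a^k · v_j = b^k · z_(j−k) − (a − b) K + a r₀ − b r₁ ,
-- so v_j ∈ [−d, c] as soon as (a − b) K lies in an explicit interval.  That interval has
-- length about a^k − 2(a+b) b^k, which is ≥ a − b once (a/b)^k ≥ 2(a+b); a Bernoulli-type
-- estimate provides such a k, and K = ⌊U/(a−b)⌋ for the upper end U of the interval.

open import Defs
open import Data.Nat using (ℕ)

module CarryValue where
  open import Data.Nat as ℕ using (ℕ; zero; suc)
  import Data.Nat.Properties as ℕ
  open import Data.Integer as ℤ using (ℤ; +_; -[1+_]; 0ℤ; 1ℤ; ∣_∣)
  import Data.Integer.Tactic.RingSolver as ℤ-Ring
  open import Data.Rational as ℚ using (ℚ; 0ℚ; 1ℚ; _+_; _-_; _*_; -_; toℚᵘ)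
  import Data.Rational.Properties as ℚ
  open import Data.Rational.Unnormalised as ℚᵘ using (mkℚᵘ; *≡*) renaming (_≃_ to _≃ᵘ_)
  import Data.Rational.Unnormalised.Properties as ℚᵘ
  open import Data.List using (map; foldr; applyUpTo; upTo)
  import Data.List.Properties as List
  open import Data.Product using (_,_)
  open import Data.Maybe using (Maybe; nothing; just)
  open import Function using (_∘_; id)
  open import Level using (0ℓ)
  open import Relation.Binary.PropositionalEquality
  open import Relation.Nullary using (yes; no)
  open import Tactic.RingSolver using (solve-∀)
  open import Tactic.RingSolver.Core.AlmostCommutativeRing using (AlmostCommutativeRing; fromCommutativeRing)

  ℚ-ring : AlmostCommutativeRing 0ℓ 0ℓ
  ℚ-ring = fromCommutativeRing ℚ.+-*-commutativeRing zero?
    where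
    zero? : ∀ x → Maybe (0ℚ ≡ x)
    zero? x with 0ℚ ℚ.≟ x
    ... | yes p = just p
    ... | no _  = nothing

  ι : ℤ → ℚ
  ι x = x ℚ./ 1

  private
    sum-frac : ∀ x y → (x ℤ.+ y) ℤ.* (+ 1 ℤ.* + 1) ≡ (x ℤ.* + 1 ℤ.+ y ℤ.* + 1) ℤ.* + 1
    sum-frac = ℤ-Ring.solve-∀
    prod-frac : ∀ x y → (x ℤ.* y) ℤ.* (+ 1 ℤ.* + 1) ≡ (x ℤ.* y) ℤ.* + 1
    prod-frac = ℤ-Ring.solve-∀
    cancel-frac : ∀ n y → (n ℤ.* y) ℤ.* + 1 ≡ y ℤ.* (+ 1 ℤ.* n)
    cancel-frac = ℤ-Ring.solve-∀

  ι≃ : ∀ x → toℚᵘ (ι x) ≃ᵘ mkℚᵘ x 0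
  ι≃ x = ℚ.toℚᵘ-fromℚᵘ (mkℚᵘ x 0)

  ι-+ : ∀ x y → ι (x ℤ.+ y) ≡ ι x + ι y
  ι-+ x y = ℚ.toℚᵘ-injective (begin
      toℚᵘ (ι (x ℤ.+ y))            ≈⟨ ι≃ (x ℤ.+ y) ⟩
      mkℚᵘ (x ℤ.+ y) 0              ≈⟨ *≡* (sum-frac x y) ⟩
      mkℚᵘ x 0 ℚᵘ.+ mkℚᵘ y 0        ≈⟨ ℚᵘ.+-cong (ι≃ x) (ι≃ y) ⟨
      toℚᵘ (ι x) ℚᵘ.+ toℚᵘ (ι y)    ≈⟨ ℚ.toℚᵘ-homo-+ (ι x) (ι y) ⟨
      toℚᵘ (ι x + ι y)              ∎)
    where open ℚᵘ.≃-Reasoning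

  ι-* : ∀ x y → ι (x ℤ.* y) ≡ ι x * ι y
  ι-* x y = ℚ.toℚᵘ-injective (begin
      toℚᵘ (ι (x ℤ.* y))            ≈⟨ ι≃ (x ℤ.* y) ⟩
      mkℚᵘ (x ℤ.* y) 0              ≈⟨ *≡* (prod-frac x y) ⟩
      mkℚᵘ x 0 ℚᵘ.* mkℚᵘ y 0        ≈⟨ ℚᵘ.*-cong (ι≃ x) (ι≃ y) ⟨
      toℚᵘ (ι x) ℚᵘ.* toℚᵘ (ι y)    ≈⟨ ℚ.toℚᵘ-homo-* (ι x) (ι y) ⟨
      toℚᵘ (ι x * ι y)              ∎)
    where open ℚᵘ.≃-Reasoning

  ι-neg : ∀ x → ι (ℤ.- x) ≡ - ι x
  ι-neg x = ℚ.toℚᵘ-injective (begin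
      toℚᵘ (ι (ℤ.- x))     ≈⟨ ι≃ (ℤ.- x) ⟩
      mkℚᵘ (ℤ.- x) 0       ≈⟨ ℚᵘ.-‿cong (ι≃ x) ⟨
      ℚᵘ.- toℚᵘ (ι x)      ≈⟨ ℚ.toℚᵘ-homo‿- (ι x) ⟨
      toℚᵘ (- ι x)         ∎)
    where open ℚᵘ.≃-Reasoning

  ι-- : ∀ x y → ι (x ℤ.- y) ≡ ι x - ι y
  ι-- x y = trans (ι-+ x (ℤ.- y)) (cong (_+_ (ι x)) (ι-neg y))

  ι-cancel : ∀ n y → ι (+ suc n) * (+ y ℚ./ suc n) ≡ ι (+ y)
  ι-cancel n y = ℚ.toℚᵘ-injective (begin
      toℚᵘ (ι (+ suc n) * (+ y ℚ./ suc n))                ≈⟨ ℚ.toℚᵘ-homo-* (ι (+ suc n)) (+ y ℚ./ suc n) ⟩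
      toℚᵘ (ι (+ suc n)) ℚᵘ.* toℚᵘ (+ y ℚ./ suc n)        ≈⟨ ℚᵘ.*-cong (ι≃ (+ suc n)) (ℚ.toℚᵘ-fromℚᵘ (mkℚᵘ (+ y) n)) ⟩
      mkℚᵘ (+ suc n) 0 ℚᵘ.* mkℚᵘ (+ y) n                  ≈⟨ *≡* (cancel-frac (+ suc n) (+ y)) ⟩
      mkℚᵘ (+ y) 0                                         ≈⟨ ι≃ (+ y) ⟨
      toℚᵘ (ι (+ y))                                       ∎)
    where open ℚᵘ.≃-Reasoning

  rangeSum : ℕ → (ℕ → ℚ) → ℚ
  rangeSum zero    F = 0ℚ
  rangeSum (suc n) F = F 0 + rangeSum n (F ∘ suc)

  rangeSum-last : ∀ n F → rangeSum (suc n) F ≡ rangeSum n F + F n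
  rangeSum-last zero    F = trans (ℚ.+-identityʳ (F 0)) (sym (ℚ.+-identityˡ (F 0)))
  rangeSum-last (suc n) F = begin
    F 0 + rangeSum (suc n) (F ∘ suc)          ≡⟨ cong (_+_ (F 0)) (rangeSum-last n (F ∘ suc)) ⟩
    F 0 + (rangeSum n (F ∘ suc) + F (suc n))  ≡⟨ ℚ.+-assoc (F 0) _ _ ⟨
    rangeSum (suc n) F + F (suc n)            ∎
    where open ≡-Reasoning

  rangeSum-cong : ∀ n {F G} → (∀ i → F i ≡ G i) → rangeSum n F ≡ rangeSum n G
  rangeSum-cong zero    F≗G = refl
  rangeSum-cong (suc n) F≗G = cong₂ _+_ (F≗G 0) (rangeSum-cong n (F≗G ∘ suc))

  foldr-applyUpTo : ∀ n (g : ℕ → ℕ) (F : ℕ → ℚ) → foldr _+_ 0ℚ (map F (applyUpTo g n)) ≡ rangeSum n (F ∘ g)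
  foldr-applyUpTo zero    g F = refl
  foldr-applyUpTo (suc n) g F = cong (_+_ (F (g 0))) (foldr-applyUpTo n (g ∘ suc) F)

  windowSum : ℕ → (ℤ → ℚ) → ℚ
  windowSum N T = foldr _+_ 0ℚ (map T (window N))

  windowSum-as-range : ∀ N T → windowSum N T ≡ rangeSum (suc (2 ℕ.* N)) (λ i → T (+ i ℤ.- + N))
  windowSum-as-range N T = begin
    foldr _+_ 0ℚ (map T (map (λ i → + i ℤ.- + N) (upTo (suc (2 ℕ.* N)))))
      ≡⟨ cong (foldr _+_ 0ℚ) (List.map-∘ {g = T} {f = λ i → + i ℤ.- + N} (upTo (suc (2 ℕ.* N)))) ⟨
    foldr _+_ 0ℚ (map (λ i → T (+ i ℤ.- + N)) (upTo (suc (2 ℕ.* N))))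
      ≡⟨ foldr-applyUpTo (suc (2 ℕ.* N)) id (λ i → T (+ i ℤ.- + N)) ⟩
    rangeSum (suc (2 ℕ.* N)) (λ i → T (+ i ℤ.- + N))                        ∎
    where open ≡-Reasoning

  windowSum-cong : ∀ N {F G} → (∀ j → F j ≡ G j) → windowSum N F ≡ windowSum N G
  windowSum-cong N F≗G = cong (foldr _+_ 0ℚ) (List.map-cong F≗G (window N))

  private
    shift-index : ∀ i N → (1ℤ ℤ.+ i) ℤ.- (1ℤ ℤ.+ N) ≡ i ℤ.- N
    shift-index = ℤ-Ring.solve-∀
    top-index : ∀ N → (1ℤ ℤ.+ (1ℤ ℤ.+ (N ℤ.+ (N ℤ.+ 0ℤ)))) ℤ.- (1ℤ ℤ.+ N) ≡ 1ℤ ℤ.+ N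
    top-index = ℤ-Ring.solve-∀

  windowSum-suc : ∀ N T → windowSum (suc N) T ≡ T -[1+ N ] + (windowSum N T + T (+ suc N))
  windowSum-suc N T = begin
    windowSum (suc N) T                                        ≡⟨ windowSum-as-range (suc N) T ⟩
    T -[1+ N ] + rangeSum (2 ℕ.* suc N) F                      ≡⟨ cong (λ n → T -[1+ N ] + rangeSum n F) (ℕ.*-suc 2 N) ⟩
    T -[1+ N ] + rangeSum (suc (suc (2 ℕ.* N))) F              ≡⟨ cong (_+_ (T -[1+ N ])) (rangeSum-last (suc (2 ℕ.* N)) F) ⟩
    T -[1+ N ] + (rangeSum (suc (2 ℕ.* N)) F + F (suc (2 ℕ.* N)))
       ≡⟨ cong₂ (λ x y → T -[1+ N ] + (x + y))
            (trans (rangeSum-cong (suc (2 ℕ.* N)) (λ i → cong T (shift-index (+ i) (+ N)))) (sym (windowSum-as-range N T)))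
            (cong T (top-index (+ N))) ⟩
    T -[1+ N ] + (windowSum N T + T (+ suc N))                 ∎
    where
    open ≡-Reasoning
    F : ℕ → ℚ
    F i = T (+ suc i ℤ.- + suc N)

  private
    +-pair-base : ∀ x y → (x + y) + 0ℚ ≡ (x + 0ℚ) + (y + 0ℚ)
    +-pair-base = solve-∀ ℚ-ring
    +-pair-step : ∀ x y s t u v → (x + y) + ((s + t) + (u + v)) ≡ (x + (s + u)) + (y + (t + v))
    +-pair-step = solve-∀ ℚ-ring
    telescope-step : ∀ x y z w → (x - y) + ((y - z) + (z - w)) ≡ x - w
    telescope-step = solve-∀ ℚ-ring

  windowSum-+ : ∀ N F G → windowSum N (λ j → F j + G j) ≡ windowSum N F + windowSum N G
  windowSum-+ zero    F G = +-pair-base (F (+ 0)) (G (+ 0))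
  windowSum-+ (suc N) F G = begin
    windowSum (suc N) (λ j → F j + G j)
      ≡⟨ windowSum-suc N (λ j → F j + G j) ⟩
    (F -[1+ N ] + G -[1+ N ]) + (windowSum N (λ j → F j + G j) + (F (+ suc N) + G (+ suc N)))
      ≡⟨ cong (λ s → (F -[1+ N ] + G -[1+ N ]) + (s + (F (+ suc N) + G (+ suc N)))) (windowSum-+ N F G) ⟩
    (F -[1+ N ] + G -[1+ N ]) + ((windowSum N F + windowSum N G) + (F (+ suc N) + G (+ suc N)))
      ≡⟨ +-pair-step (F -[1+ N ]) (G -[1+ N ]) (windowSum N F) (windowSum N G) (F (+ suc N)) (G (+ suc N)) ⟩
    (F -[1+ N ] + (windowSum N F + F (+ suc N))) + (G -[1+ N ] + (windowSum N G + G (+ suc N)))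
      ≡⟨ cong₂ _+_ (windowSum-suc N F) (windowSum-suc N G) ⟨
    windowSum (suc N) F + windowSum (suc N) G
      ∎
    where open ≡-Reasoning

  windowSum-telescope : ∀ N (D : ℤ → ℚ) → windowSum N (λ j → D (j ℤ.- 1ℤ) - D j) ≡ D -[1+ N ] - D (+ N)
  windowSum-telescope zero    D = ℚ.+-identityʳ _
  windowSum-telescope (suc N) D = begin
    windowSum (suc N) Δ                                                        ≡⟨ windowSum-suc N Δ ⟩
    Δ -[1+ N ] + (windowSum N Δ + Δ (+ suc N))                                  ≡⟨ cong (λ s → Δ -[1+ N ] + (s + Δ (+ suc N))) (windowSum-telescope N D) ⟩
    (D (-[1+ N ] ℤ.- 1ℤ) - D -[1+ N ]) + ((D -[1+ N ] - D (+ N)) + (D (+ N) - D (+ suc N)))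
       ≡⟨ telescope-step (D (-[1+ N ] ℤ.- 1ℤ)) (D -[1+ N ]) (D (+ N)) (D (+ suc N)) ⟩
    D (-[1+ N ] ℤ.- 1ℤ) - D (+ suc N)                                           ≡⟨ cong (λ j → D j - D (+ suc N)) (cong -[1+_] (cong suc (ℕ.+-identityʳ N))) ⟩
    D -[1+ suc N ] - D (+ suc N)                                                 ∎
    where
    open ≡-Reasoning
    Δ : ℤ → ℚ
    Δ j = D (j ℤ.- 1ℤ) - D j

  windowSum-extend : ∀ N M T → N ℕ.≤ M → (∀ j → N ℕ.< ∣ j ∣ → T j ≡ 0ℚ) → windowSum M T ≡ windowSum N T
  windowSum-extend N M T N≤M vanish with ℕ.m≤n⇒∃[o]m+o≡n N≤M
  ... | k , refl = extend k
    where
    open ≡-Reasoning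
    extend : ∀ k → windowSum (N ℕ.+ k) T ≡ windowSum N T
    extend zero    = cong (λ n → windowSum n T) (ℕ.+-identityʳ N)
    extend (suc k) = begin
      windowSum (N ℕ.+ suc k) T                                         ≡⟨ trans (cong (λ n → windowSum n T) (ℕ.+-suc N k)) (windowSum-suc (N ℕ.+ k) T) ⟩
      T -[1+ N ℕ.+ k ] + (windowSum (N ℕ.+ k) T + T (+ suc (N ℕ.+ k)))   ≡⟨ cong₂ (λ x y → x + (windowSum (N ℕ.+ k) T + y)) (vanish _ far) (vanish _ far) ⟩
      0ℚ + (windowSum (N ℕ.+ k) T + 0ℚ)                                  ≡⟨ trans (ℚ.+-identityˡ _) (ℚ.+-identityʳ _) ⟩
      windowSum (N ℕ.+ k) T                                              ≡⟨ extend k ⟩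
      windowSum N T                                                      ∎
      where
      far : N ℕ.< suc (N ℕ.+ k)
      far = ℕ.s≤s (ℕ.m≤m+n N k)

  βpow-shift : ∀ a b j → ι (+ suc b) * βpow (suc a) (suc b) j ≡ ι (+ suc a) * βpow (suc a) (suc b) (j ℤ.- 1ℤ)
  βpow-shift a b (+ zero)  = begin
    ι (+ suc b) * 1ℚ                          ≡⟨ cong (_* 1ℚ) (ι-cancel a (suc b)) ⟨
    (ι (+ suc a) * (+ suc b ℚ./ suc a)) * 1ℚ  ≡⟨ ℚ.*-assoc (ι (+ suc a)) _ 1ℚ ⟩
    ι (+ suc a) * ((+ suc b ℚ./ suc a) * 1ℚ)  ∎
    where open ≡-Reasoning
  βpow-shift a b (+ suc n) = begin
    ι (+ suc b) * ((+ suc a ℚ./ suc b) * q)   ≡⟨ ℚ.*-assoc (ι (+ suc b)) _ q ⟨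
    (ι (+ suc b) * (+ suc a ℚ./ suc b)) * q   ≡⟨ cong (_* q) (ι-cancel b (suc a)) ⟩
    ι (+ suc a) * q                           ∎
    where
    open ≡-Reasoning
    q = qpow (+ suc a ℚ./ suc b) n
  βpow-shift a b -[1+ n ]  = begin
    ι (+ suc b) * q                           ≡⟨ cong (_* q) (ι-cancel a (suc b)) ⟨
    (ι (+ suc a) * (+ suc b ℚ./ suc a)) * q   ≡⟨ ℚ.*-assoc (ι (+ suc a)) _ q ⟩
    ι (+ suc a) * βpow (suc a) (suc b) -[1+ suc n ]
                                              ≡⟨ cong (λ i → ι (+ suc a) * βpow (suc a) (suc b) -[1+ suc i ]) (ℕ.+-identityʳ n) ⟨
    ι (+ suc a) * βpow (suc a) (suc b) (-[1+ n ] ℤ.- 1ℤ) ∎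
    where
    open ≡-Reasoning
    q = qpow (+ suc b ℚ./ suc a) (suc n)

  private
    carry-regroup : ∀ x y z a b β → (x + b * y - a * z) * β ≡ x * β + (y * (b * β) - z * (a * β))
    carry-regroup = solve-∀ ℚ-ring

  carry-preserves-value : ∀ a b (z c : ℤ → ℤ) N M → N ℕ.≤ M →
    (∀ j → N ℕ.< ∣ j ∣ → z j ≡ 0ℤ) → (∀ j → M ℕ.< ∣ j ∣ → c j ≡ 0ℤ) →
    windowSum (suc M) (λ j → ι (z j ℤ.+ + suc b ℤ.* c (j ℤ.- 1ℤ) ℤ.- + suc a ℤ.* c j) * βpow (suc a) (suc b) j)
      ≡ windowSum N (λ j → ι (z j) * βpow (suc a) (suc b) j)
  carry-preserves-value a b z c N M N≤M z-vanishes c-vanishes = begin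
    windowSum (suc M) (λ j → ι (v j) * β j)           ≡⟨ windowSum-cong (suc M) digit-term ⟩
    windowSum (suc M) (λ j → Z j + Δ j)               ≡⟨ windowSum-+ (suc M) Z Δ ⟩
    windowSum (suc M) Z + windowSum (suc M) Δ         ≡⟨ cong (_+_ (windowSum (suc M) Z)) (windowSum-telescope (suc M) D) ⟩
    windowSum (suc M) Z + (D -[1+ suc M ] - D (+ suc M))
                                                      ≡⟨ cong₂ (λ x y → windowSum (suc M) Z + (x - y)) (D-vanishes _ (ℕ.m≤n⇒m≤1+n (ℕ.n<1+n M))) (D-vanishes _ (ℕ.n<1+n M)) ⟩
    windowSum (suc M) Z + (0ℚ - 0ℚ)                   ≡⟨ ℚ.+-identityʳ (windowSum (suc M) Z) ⟩
    windowSum (suc M) Z                               ≡⟨ windowSum-extend N (suc M) Z (ℕ.m≤n⇒m≤1+n N≤M) Z-vanishes ⟩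
    windowSum N Z                                     ∎
    where
    open ≡-Reasoning
    β : ℤ → ℚ
    β = βpow (suc a) (suc b)
    v : ℤ → ℤ
    v j = z j ℤ.+ + suc b ℤ.* c (j ℤ.- 1ℤ) ℤ.- + suc a ℤ.* c j
    Z D Δ : ℤ → ℚ
    Z j = ι (z j) * β j
    D j = ι (c j) * (ι (+ suc a) * β j)
    Δ j = D (j ℤ.- 1ℤ) - D j

    digit-term : ∀ j → ι (v j) * β j ≡ Z j + Δ j
    digit-term j = begin
      ι (v j) * β j
        ≡⟨ cong (_* β j) (trans (ι-- (z j ℤ.+ + suc b ℤ.* c′) (+ suc a ℤ.* c j))
            (cong₂ _-_ (trans (ι-+ (z j) (+ suc b ℤ.* c′)) (cong (_+_ (ι (z j))) (ι-* (+ suc b) c′)))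
                       (ι-* (+ suc a) (c j)))) ⟩
      (ι (z j) + ι (+ suc b) * ι (c (j ℤ.- 1ℤ)) - ι (+ suc a) * ι (c j)) * β j
        ≡⟨ carry-regroup (ι (z j)) (ι (c (j ℤ.- 1ℤ))) (ι (c j)) (ι (+ suc a)) (ι (+ suc b)) (β j) ⟩
      Z j + (ι (c (j ℤ.- 1ℤ)) * (ι (+ suc b) * β j) - D j)
        ≡⟨ cong (λ x → Z j + (ι (c (j ℤ.- 1ℤ)) * x - D j)) (βpow-shift a b j) ⟩
      Z j + Δ j ∎
      where c′ = c (j ℤ.- 1ℤ)

    D-vanishes : ∀ j → M ℕ.< ∣ j ∣ → D j ≡ 0ℚ
    D-vanishes j far = trans (cong (λ x → ι x * (ι (+ suc a) * β j)) (c-vanishes j far)) (ℚ.*-zeroˡ (ι (+ suc a) * β j))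

    Z-vanishes : ∀ j → N ℕ.< ∣ j ∣ → Z j ≡ 0ℚ
    Z-vanishes j far = trans (cong (λ x → ι x * β j) (z-vanishes j far)) (ℚ.*-zeroˡ (β j))

module CarryRule where
  open import Data.Nat as ℕ using (ℕ; zero; suc; NonZero)
  import Data.Nat.Properties as ℕ
  import Data.Nat.DivMod as ℕ
  open import Data.Integer as ℤ using (ℤ; +_; 0ℤ; _+_; _-_; _*_; _≤_; _<_; _/ℕ_; _%ℕ_; +≤+; +<+)
  import Data.Integer.Properties as ℤ
  import Data.Integer.DivMod as ℤ
  open import Data.Integer.Tactic.RingSolver using (solve-∀; solve)
  open import Data.List using ([]; _∷_)
  open import Data.Fin as Fin using (Fin; inject₁; fromℕ)
  open import Function using (_∘_)
  open import Relation.Binary.PropositionalEquality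

  module WeightedSums (a b : ℕ) where

    -- weightedSum n w = Σ_{i<n} a^(n−1−i) b^i w_i
    weightedSum : ∀ n → (Fin n → ℤ) → ℤ
    weightedSum zero    w = 0ℤ
    weightedSum (suc n) w = + (a ℕ.^ n) * w Fin.zero + + b * weightedSum n (w ∘ Fin.suc)

    weightedSum-cong : ∀ n {w w′ : Fin n → ℤ} → (∀ i → w i ≡ w′ i) → weightedSum n w ≡ weightedSum n w′
    weightedSum-cong zero    w≗w′ = refl
    weightedSum-cong (suc n) w≗w′ =
      cong₂ (λ x s → + (a ℕ.^ n) * x + + b * s) (w≗w′ Fin.zero) (weightedSum-cong n (w≗w′ ∘ Fin.suc))

    weightedSum-zero : ∀ n → weightedSum n (λ _ → 0ℤ) ≡ 0ℤ
    weightedSum-zero zero    = refl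
    weightedSum-zero (suc n) = begin
      + (a ℕ.^ n) * 0ℤ + + b * weightedSum n (λ _ → 0ℤ)  ≡⟨ cong (λ s → + (a ℕ.^ n) * 0ℤ + + b * s) (weightedSum-zero n) ⟩
      + (a ℕ.^ n) * 0ℤ + + b * 0ℤ                        ≡⟨ cong₂ _+_ (ℤ.*-zeroʳ (+ (a ℕ.^ n))) (ℤ.*-zeroʳ (+ b)) ⟩
      0ℤ                                                  ∎
      where open ≡-Reasoning

    private
      telescope-base : ∀ w a b → + 1 * w + b * 0ℤ - a * 0ℤ ≡ + 1 * w
      telescope-base = solve-∀
      telescope-step : ∀ A Aⁿ B w₀ w₁ S₁ S₀ →
        A * Aⁿ * w₀ + B * (Aⁿ * w₁ + B * S₁) - A * (Aⁿ * w₀ + B * S₀) ≡ B * (Aⁿ * w₁ + B * S₁ - A * S₀)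
      telescope-step = solve-∀

    weightedSum-telescope : ∀ n (w : Fin (suc n) → ℤ) →
      + (a ℕ.^ n) * w Fin.zero + + b * weightedSum n (w ∘ Fin.suc) - + a * weightedSum n (w ∘ inject₁) ≡ + (b ℕ.^ n) * w (fromℕ n)
    weightedSum-telescope zero    w = telescope-base (w Fin.zero) (+ a) (+ b)
    weightedSum-telescope (suc n) w = begin
      + (a ℕ.^ suc n) * w Fin.zero + + b * weightedSum (suc n) (w ∘ Fin.suc) - + a * weightedSum (suc n) (w ∘ inject₁)
        ≡⟨ cong (λ x → x * w Fin.zero + + b * weightedSum (suc n) (w ∘ Fin.suc) - + a * weightedSum (suc n) (w ∘ inject₁)) (ℤ.pos-* a (a ℕ.^ n)) ⟩
      + a * + (a ℕ.^ n) * w Fin.zero + + b * weightedSum (suc n) (w ∘ Fin.suc) - + a * weightedSum (suc n) (w ∘ inject₁)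
        ≡⟨ telescope-step (+ a) (+ (a ℕ.^ n)) (+ b) (w Fin.zero) (w (Fin.suc Fin.zero))
             (weightedSum n (w ∘ Fin.suc ∘ Fin.suc)) (weightedSum n (w ∘ Fin.suc ∘ inject₁)) ⟩
      + b * (+ (a ℕ.^ n) * w (Fin.suc Fin.zero) + + b * weightedSum n (w ∘ Fin.suc ∘ Fin.suc) - + a * weightedSum n (w ∘ Fin.suc ∘ inject₁))
        ≡⟨ cong (+ b *_) (weightedSum-telescope n (w ∘ Fin.suc)) ⟩
      + b * (+ (b ℕ.^ n) * w (Fin.suc (fromℕ n)))
        ≡⟨ ℤ.*-assoc (+ b) (+ (b ℕ.^ n)) _ ⟨
      + b * + (b ℕ.^ n) * w (Fin.suc (fromℕ n))
        ≡⟨ cong (_* w (Fin.suc (fromℕ n))) (ℤ.pos-* b (b ℕ.^ n)) ⟨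
      + (b ℕ.^ suc n) * w (fromℕ (suc n))
        ∎
      where open ≡-Reasoning

  module LocalCarry (a b k : ℕ) .{{_ : NonZero a}} (K : ℤ) where
    open WeightedSums a b public

    A : ℕ
    A = a ℕ.^ k

    instance
      A≢0 : NonZero A
      A≢0 = ℕ.m^n≢0 a k

    carry : (Fin k → ℤ) → ℤ
    carry w = (weightedSum k w + K) /ℕ A

    remainder : (Fin k → ℤ) → ℕ
    remainder w = (weightedSum k w + K) %ℕ A

    private
      rearrange : ∀ n r q A → n ≡ r + q * A → A * q ≡ n - r
      rearrange _ r q A refl = solve (r ∷ q ∷ A ∷ [])
      distribute : ∀ A w₀ a b c₁ c₀ → A * (w₀ + b * c₁ - a * c₀) ≡ A * w₀ + b * (A * c₁) - a * (A * c₀)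
      distribute = solve-∀
      collect : ∀ A w₀ a b S₁ S₀ K r₁ r₀ →
        A * w₀ + b * (S₁ + K - r₁) - a * (S₀ + K - r₀) ≡ (A * w₀ + b * S₁ - a * S₀) - (a - b) * K + a * r₀ - b * r₁
      collect = solve-∀

    carry-spec : ∀ w → + A * carry w ≡ weightedSum k w + K - + remainder w
    carry-spec w = rearrange _ (+ remainder w) (carry w) (+ A) (ℤ.a≡a%ℕn+[a/ℕn]*n (weightedSum k w + K) A)

    remainder<A : ∀ w → remainder w ℕ.< A
    remainder<A w = ℤ.n%ℕd<d (weightedSum k w + K) A

    carry-cong : ∀ {w w′ : Fin k → ℤ} → (∀ i → w i ≡ w′ i) → carry w ≡ carry w′
    carry-cong w≗w′ = cong (λ s → (s + K) /ℕ A) (weightedSum-cong k w≗w′)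

    carry-zero : 0ℤ ≤ K → K < + A → carry (λ _ → 0ℤ) ≡ 0ℤ
    carry-zero (+≤+ _) (+<+ K<A) =
      trans (cong (λ s → (s + K) /ℕ A) (weightedSum-zero k)) (cong +_ (ℕ.m<n⇒m/n≡0 K<A))

    -- The output digit at j, read from the window w_i = z_(j−i), i = 0 … k.
    digit : (Fin (suc k) → ℤ) → ℤ
    digit w = w Fin.zero + + b * carry (w ∘ Fin.suc) - + a * carry (w ∘ inject₁)

    digit-identity : ∀ w → + A * digit w ≡
      + (b ℕ.^ k) * w (fromℕ k) - (+ a - + b) * K + + a * + remainder (w ∘ inject₁) - + b * + remainder (w ∘ Fin.suc)
    digit-identity w = begin
      + A * digit w
        ≡⟨ distribute (+ A) (w Fin.zero) (+ a) (+ b) (carry (w ∘ Fin.suc)) (carry (w ∘ inject₁)) ⟩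
      + A * w Fin.zero + + b * (+ A * carry (w ∘ Fin.suc)) - + a * (+ A * carry (w ∘ inject₁))
        ≡⟨ cong₂ (λ x y → + A * w Fin.zero + + b * x - + a * y) (carry-spec (w ∘ Fin.suc)) (carry-spec (w ∘ inject₁)) ⟩
      + A * w Fin.zero + + b * (S₁ + K - + r₁) - + a * (S₀ + K - + r₀)
        ≡⟨ collect (+ A) (w Fin.zero) (+ a) (+ b) S₁ S₀ K (+ r₁) (+ r₀) ⟩
      (+ A * w Fin.zero + + b * S₁ - + a * S₀) - (+ a - + b) * K + + a * + r₀ - + b * + r₁
        ≡⟨ cong (λ x → x - (+ a - + b) * K + + a * + r₀ - + b * + r₁) (weightedSum-telescope k w) ⟩
      + (b ℕ.^ k) * w (fromℕ k) - (+ a - + b) * K + + a * + r₀ - + b * + r₁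
        ∎
      where
      open ≡-Reasoning
      S₀ = weightedSum k (w ∘ inject₁)
      S₁ = weightedSum k (w ∘ Fin.suc)
      r₀ = remainder (w ∘ inject₁)
      r₁ = remainder (w ∘ Fin.suc)

module DigitBounds where
  import Data.Nat as ℕ
  open import Data.Integer as ℤ using (ℤ; +_; -[1+_]; 0ℤ; 1ℤ; _+_; _-_; _*_; -_; _≤_; _<_; +≤+; +<+)
  import Data.Integer.Properties as ℤ
  open import Data.Integer.Tactic.RingSolver using (solve-∀)
  open import Relation.Binary.PropositionalEquality
  open import Relation.Nullary using (contradiction)

  0≤+ : ∀ {x y} → 0ℤ ≤ x → 0ℤ ≤ y → 0ℤ ≤ x + y
  0≤+ = ℤ.+-mono-≤

  0≤ℕ : ∀ {n} → 0ℤ ≤ + n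
  0≤ℕ = +≤+ ℕ.z≤n

  0≤* : ∀ {x y} → 0ℤ ≤ x → 0ℤ ≤ y → 0ℤ ≤ x * y
  0≤* {+ m} {+ n} _ _ = subst (0ℤ ≤_) (ℤ.pos-* m n) 0≤ℕ

  private
    negative-case : ∀ A N → A * - (1ℤ + N) + (A - 1ℤ) ≡ - (1ℤ + A * N)
    negative-case = solve-∀

  nonneg-by-floor : ∀ {A x} → 0ℤ < A → 0ℤ ≤ A * x + (A - 1ℤ) → 0ℤ ≤ x
  nonneg-by-floor {A} {+ n}      _   _  = 0≤ℕ
  nonneg-by-floor {A} { -[1+ n ]} 0<A 0≤ =
    contradiction (subst (0ℤ ≤_) (negative-case A (+ n)) 0≤) (ℤ.<⇒≱ (ℤ.neg-mono-< (0<1+ (0≤* (ℤ.<⇒≤ 0<A) 0≤ℕ))))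
    where
    0<1+ : ∀ {y} → 0ℤ ≤ y → 0ℤ < 1ℤ + y
    0<1+ {+ m} _ = +<+ (ℕ.s≤s ℕ.z≤n)

  private
    lower-expand : ∀ A v d → A * (v - - d) + (A - 1ℤ) ≡ A * v + (A * d + A - 1ℤ)
    lower-expand = solve-∀
    lower-collect : ∀ A B a b d K w r₀ r₁ →
      B * w - (a - b) * K + a * r₀ - b * r₁ + (A * d + A - 1ℤ)
        ≡ B * (w - (- d - d)) + a * r₀ + b * (A - (1ℤ + r₁)) + (((d - b + 1ℤ) * A - + 2 * d * B + b - 1ℤ) - (a - b) * K)
    lower-collect = solve-∀
    upper-expand : ∀ A v c → A * (c - v) + (A - 1ℤ) ≡ (A * c + A - 1ℤ) - A * v
    upper-expand = solve-∀
    upper-collect : ∀ A B a b c K w r₀ r₁ →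
      (A * c + A - 1ℤ) - (B * w - (a - b) * K + a * r₀ - b * r₁)
        ≡ B * ((c + c) - w) + a * (A - (1ℤ + r₀)) + b * r₁ + ((a - b) * K - ((a - c - 1ℤ) * A + + 2 * c * B - a + 1ℤ))
    upper-collect = solve-∀

  digit-≥ : ∀ {A B a b d K v w r₀ r₁} → 0ℤ < A → 0ℤ ≤ B → 0ℤ ≤ a → 0ℤ ≤ b → 0ℤ ≤ r₀ → r₁ < A →
    A * v ≡ B * w - (a - b) * K + a * r₀ - b * r₁ →
    - d - d ≤ w → (a - b) * K ≤ (d - b + 1ℤ) * A - + 2 * d * B + b - 1ℤ →
    - d ≤ v
  digit-≥ {A} {B} {a} {b} {d} {K} {v} {w} {r₀} {r₁} 0<A 0≤B 0≤a 0≤b 0≤r₀ r₁<A Av≡ w≥ K≤ =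
    ℤ.0≤i-j⇒j≤i (nonneg-by-floor 0<A (subst (0ℤ ≤_) (sym identity) nonneg))
    where
    identity : A * (v - - d) + (A - 1ℤ) ≡ B * (w - (- d - d)) + a * r₀ + b * (A - (1ℤ + r₁)) + (((d - b + 1ℤ) * A - + 2 * d * B + b - 1ℤ) - (a - b) * K)
    identity = trans (lower-expand A v d) (trans (cong (_+ (A * d + A - 1ℤ)) Av≡) (lower-collect A B a b d K w r₀ r₁))
    nonneg : 0ℤ ≤ B * (w - (- d - d)) + a * r₀ + b * (A - (1ℤ + r₁)) + (((d - b + 1ℤ) * A - + 2 * d * B + b - 1ℤ) - (a - b) * K)
    nonneg = 0≤+ (0≤+ (0≤+ (0≤* 0≤B (ℤ.i≤j⇒0≤j-i w≥)) (0≤* 0≤a 0≤r₀)) (0≤* 0≤b (ℤ.i≤j⇒0≤j-i (ℤ.i<j⇒suc[i]≤j r₁<A)))) (ℤ.i≤j⇒0≤j-i K≤)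

  digit-≤ : ∀ {A B a b c K v w r₀ r₁} → 0ℤ < A → 0ℤ ≤ B → 0ℤ ≤ a → 0ℤ ≤ b → r₀ < A → 0ℤ ≤ r₁ →
    A * v ≡ B * w - (a - b) * K + a * r₀ - b * r₁ →
    w ≤ c + c → (a - c - 1ℤ) * A + + 2 * c * B - a + 1ℤ ≤ (a - b) * K →
    v ≤ c
  digit-≤ {A} {B} {a} {b} {c} {K} {v} {w} {r₀} {r₁} 0<A 0≤B 0≤a 0≤b r₀<A 0≤r₁ Av≡ w≤ K≥ =
    ℤ.0≤i-j⇒j≤i (nonneg-by-floor 0<A (subst (0ℤ ≤_) (sym identity) nonneg))
    where
    identity : A * (c - v) + (A - 1ℤ) ≡ B * ((c + c) - w) + a * (A - (1ℤ + r₀)) + b * r₁ + ((a - b) * K - ((a - c - 1ℤ) * A + + 2 * c * B - a + 1ℤ))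
    identity = trans (upper-expand A v c) (trans (cong (_-_ (A * c + A - 1ℤ)) Av≡) (upper-collect A B a b c K w r₀ r₁))
    nonneg : 0ℤ ≤ B * ((c + c) - w) + a * (A - (1ℤ + r₀)) + b * r₁ + ((a - b) * K - ((a - c - 1ℤ) * A + + 2 * c * B - a + 1ℤ))
    nonneg = 0≤+ (0≤+ (0≤+ (0≤* 0≤B (ℤ.i≤j⇒0≤j-i w≤)) (0≤* 0≤a (ℤ.i≤j⇒0≤j-i (ℤ.i<j⇒suc[i]≤j r₀<A)))) (0≤* 0≤b 0≤r₁)) (ℤ.i≤j⇒0≤j-i K≥)

-- Over integer unknowns G, E, F, B, H ≥ 0
-- put b = 1 + G, d = b + E, a = 1 + d + F (so that c = a + b − d − 1 = b + F and
-- m = a − b = 1 + E + F) and A = 2(a + b)B + H.  The ends of the interval for m·K,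
--   U = (d − b + 1)A − 2dB + b − 1   and   L = (a − c − 1)A + 2cB − a + 1,
-- satisfy U ≥ 0, U < m·A (when B ≥ 1) and L ≤ U + 1 − m.
module OffsetArithmetic where
  open import Data.Integer as ℤ using (ℤ; +_; 0ℤ; 1ℤ; _+_; _-_; _*_; _≤_; _<_)
  import Data.Integer.Properties as ℤ
  open import Data.Integer.Tactic.RingSolver using (solve-∀)
  open import Relation.Binary.PropositionalEquality
  open DigitBounds using (0≤+; 0≤*; 0≤ℕ)

  private
    U-identity : ∀ G E F B H → let b = 1ℤ + G; d = b + E; a = 1ℤ + (d + F); A = + 2 * (a + b) * B + H; C = + 2 + G + F in
      (d - b + 1ℤ) * A - + 2 * d * B + b - 1ℤ ≡ E * A + (C + C) * B + H + G
    U-identity = solve-∀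
    room-identity : ∀ G E F B′ H → let b = 1ℤ + G; d = b + E; a = 1ℤ + (d + F); m = 1ℤ + (E + F); B = 1ℤ + B′; A = + 2 * (a + b) * B + H in
      m * A - (1ℤ + ((d - b + 1ℤ) * A - + 2 * d * B + b - 1ℤ)) ≡ F * A + (E + E) * B + (G + G) * B′ + (B′ + B′) + G + 1ℤ
    room-identity = solve-∀
    gap-identity : ∀ G E F B H → let b = 1ℤ + G; d = b + E; a = 1ℤ + (d + F); m = 1ℤ + (E + F); c = (a + b) - d - 1ℤ; A = + 2 * (a + b) * B + H in
      ((1ℤ + ((d - b + 1ℤ) * A - + 2 * d * B + b - 1ℤ)) - m) - ((a - c - 1ℤ) * A + + 2 * c * B - a + 1ℤ) ≡ (B + B) + H + (G + G) + 1ℤ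
    gap-identity = solve-∀

  upper-end-nonneg : ∀ {G E F B H A} → 0ℤ ≤ G → 0ℤ ≤ E → 0ℤ ≤ F → 0ℤ ≤ B → 0ℤ ≤ H → 0ℤ ≤ A →
    let b = 1ℤ + G; d = b + E; a = 1ℤ + (d + F) in
    A ≡ + 2 * (a + b) * B + H → 0ℤ ≤ (d - b + 1ℤ) * A - + 2 * d * B + b - 1ℤ
  upper-end-nonneg {G} {E} {F} {B} {H} 0≤G 0≤E 0≤F 0≤B 0≤H 0≤A refl =
    subst (0ℤ ≤_) (sym (U-identity G E F B H))
      (0≤+ (0≤+ (0≤+ (0≤* 0≤E 0≤A) (0≤* (0≤+ 0≤C 0≤C) 0≤B)) 0≤H) 0≤G)
    where
    0≤C : 0ℤ ≤ + 2 + G + F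
    0≤C = 0≤+ (0≤+ 0≤ℕ 0≤G) 0≤F

  upper-end<mA : ∀ {G E F B′ B H A} → 0ℤ ≤ G → 0ℤ ≤ E → 0ℤ ≤ F → 0ℤ ≤ B′ → 0ℤ ≤ A →
    let b = 1ℤ + G; d = b + E; a = 1ℤ + (d + F); m = 1ℤ + (E + F) in
    B ≡ 1ℤ + B′ → A ≡ + 2 * (a + b) * B + H → (d - b + 1ℤ) * A - + 2 * d * B + b - 1ℤ < m * A
  upper-end<mA {G} {E} {F} {B′} {B} {H} 0≤G 0≤E 0≤F 0≤B′ 0≤A refl refl =
    ℤ.suc[i]≤j⇒i<j (ℤ.0≤i-j⇒j≤i (subst (0ℤ ≤_) (sym (room-identity G E F B′ H))
      (0≤+ (0≤+ (0≤+ (0≤+ (0≤+ (0≤* 0≤F 0≤A) (0≤* (0≤+ 0≤E 0≤E) (0≤+ 0≤ℕ 0≤B′))) (0≤* (0≤+ 0≤G 0≤G) 0≤B′)) (0≤+ 0≤B′ 0≤B′)) 0≤G) 0≤ℕ)))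

  interval-long : ∀ {G E F B H A} → 0ℤ ≤ G → 0ℤ ≤ B → 0ℤ ≤ H →
    let b = 1ℤ + G; d = b + E; a = 1ℤ + (d + F); m = 1ℤ + (E + F); c = (a + b) - d - 1ℤ in
    A ≡ + 2 * (a + b) * B + H →
    (a - c - 1ℤ) * A + + 2 * c * B - a + 1ℤ ≤ (1ℤ + ((d - b + 1ℤ) * A - + 2 * d * B + b - 1ℤ)) - m
  interval-long {G} {E} {F} {B} {H} 0≤G 0≤B 0≤H refl =
    ℤ.0≤i-j⇒j≤i (subst (0ℤ ≤_) (sym (gap-identity G E F B H))
      (0≤+ (0≤+ (0≤+ (0≤+ 0≤B 0≤B) 0≤H) (0≤+ 0≤G 0≤G)) 0≤ℕ))

module Estimates where
  open import Data.Nat as ℕ using (ℕ; zero; suc; _+_; _*_; _^_; _≤_; _<_)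
  import Data.Nat.Properties as ℕ
  open import Data.Nat.Tactic.RingSolver using (solve-∀)
  open import Data.Integer as ℤ using (ℤ; +_; -[1+_]; ∣_∣)
  import Data.Integer.Properties as ℤ
  open import Relation.Binary.PropositionalEquality

  power-gap : ∀ {a b} → b < a → ∀ n → b ^ n * (b + n) ≤ a ^ n * b
  power-gap {a} {b} b<a zero    = ℕ.≤-reflexive (ℕ.+-identityʳ (b + 0))
  power-gap {a} {b} b<a (suc n) = begin
    b ^ suc n * (b + suc n)          ≡⟨ split b (b ^ n) n ⟩
    b * (b ^ n * (b + n)) + b ^ n * b ≤⟨ ℕ.+-mono-≤ (ℕ.*-monoʳ-≤ b IH) (ℕ.≤-trans (ℕ.*-monoʳ-≤ (b ^ n) (ℕ.m≤m+n b n)) IH) ⟩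
    b * (a ^ n * b) + a ^ n * b       ≡⟨ ℕ.+-comm (b * (a ^ n * b)) (a ^ n * b) ⟩
    suc b * (a ^ n * b)               ≤⟨ ℕ.*-monoˡ-≤ (a ^ n * b) b<a ⟩
    a * (a ^ n * b)                   ≡⟨ ℕ.*-assoc a (a ^ n) b ⟨
    a ^ suc n * b                     ∎
    where
    open ℕ.≤-Reasoning
    IH = power-gap b<a n
    split : ∀ b bⁿ n → b * bⁿ * (b + suc n) ≡ b * (bⁿ * (b + n)) + bⁿ * b
    split = solve-∀

  power-dominates : ∀ {a b} .{{_ : ℕ.NonZero b}} → b < a → ∀ t → t * b ^ (b * t) ≤ a ^ (b * t)
  power-dominates {a} {b} b<a t = ℕ.≤-trans (ℕ.m≤n+m (t * B) B) (ℕ.*-cancelʳ-≤ (B + t * B) (a ^ (b * t)) b (begin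
    (B + t * B) * b     ≡⟨ regroup b B t ⟩
    B * (b + b * t)     ≤⟨ power-gap b<a (b * t) ⟩
    a ^ (b * t) * b     ∎))
    where
    open ℕ.≤-Reasoning
    B = b ^ (b * t)
    regroup : ∀ b B t → (B + t * B) * b ≡ B * (b + b * t)
    regroup = solve-∀

  distant : ∀ {N k i} j → i ≤ k → k + N < ∣ j ∣ → N < ∣ j ℤ.- + i ∣
  distant {N} {k} {i} (+ n) i≤k far = subst (λ x → N < ∣ x ∣) (sym shift) (ℕ.m+n≤o⇒m≤o∸n (suc N) room)
    where
    room : suc N + i ≤ n
    room = ℕ.≤-trans (ℕ.s≤s (ℕ.≤-trans (ℕ.+-monoʳ-≤ N i≤k) (ℕ.≤-reflexive (ℕ.+-comm N k)))) far
    shift : + n ℤ.- + i ≡ + (n ℕ.∸ i)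
    shift = trans (ℤ.m-n≡m⊖n n i) (ℤ.⊖-≥ (ℕ.≤-trans (ℕ.m≤n+m i N) (ℕ.<⇒≤ room)))
  distant {N} {k} {zero}  -[1+ n ] _ far = ℕ.≤-<-trans (ℕ.m≤n+m N k) far
  distant {N} {k} {suc i} -[1+ n ] _ far = ℕ.<-≤-trans (ℕ.≤-<-trans (ℕ.m≤n+m N k) far) (ℕ.s≤s (ℕ.≤-trans (ℕ.m≤m+n n i) (ℕ.n≤1+n _)))

-- The conversion for b = 1 + g, d = b + e and a = 1 + d + f, i.e. for every 1 ≤ b ≤ d ≤ a − 1.
module Construction (g e f : ℕ) where
  open import Data.Nat as ℕ using (ℕ; suc)
  import Data.Nat.Properties as ℕ
  open import Data.Integer as ℤ using (ℤ; +_; 0ℤ; 1ℤ; ∣_∣; _+_; _-_; _*_; -_; _≤_; _<_; _/ℕ_)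
  import Data.Integer.Properties as ℤ
  import Data.Integer.DivMod as ℤ
  open import Data.Integer.Tactic.RingSolver using (solve-∀)
  open import Data.Fin as Fin using (Fin; toℕ; inject₁; fromℕ)
  import Data.Fin.Properties as Fin
  open import Data.Product using (_,_; proj₁; proj₂)
  open import Function using (_∘_)
  open import Relation.Binary.PropositionalEquality
  import Data.Rational as ℚ
  open CarryValue using (ι; windowSum; windowSum-cong; carry-preserves-value)
  open CarryRule
  open DigitBounds
  open OffsetArithmetic
  open Estimates

  b d a m : ℕ
  b = suc g
  d = b ℕ.+ e
  a = suc (d ℕ.+ f)
  m = suc (e ℕ.+ f)

  b<a : b ℕ.< a
  b<a = ℕ.s≤s (ℕ.≤-trans (ℕ.m≤m+n b e) (ℕ.m≤m+n d f))

  -- The look-back length k, chosen so that a^k ≥ 2(a + b)·b^k.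
  k A B : ℕ
  k = b ℕ.* (2 ℕ.* (a ℕ.+ b))
  A = a ℕ.^ k
  B = b ℕ.^ k

  A-large : 2 ℕ.* (a ℕ.+ b) ℕ.* B ℕ.≤ A
  A-large = power-dominates b<a (2 ℕ.* (a ℕ.+ b))

  h B′ : ℕ
  h  = proj₁ (ℕ.m≤n⇒∃[o]m+o≡n A-large)
  B′ = proj₁ (ℕ.m≤n⇒∃[o]m+o≡n (ℕ.m^n>0 b k))

  A-split : + A ≡ + 2 * (+ a + + b) * + B + + h
  A-split = trans (cong +_ (sym (proj₂ (ℕ.m≤n⇒∃[o]m+o≡n A-large))))
                  (cong (_+ + h) (trans (ℤ.pos-* (2 ℕ.* (a ℕ.+ b)) B) (cong (_* + B) (ℤ.pos-* 2 (a ℕ.+ b)))))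

  B-split : + B ≡ 1ℤ + + B′
  B-split = cong +_ (sym (proj₂ (ℕ.m≤n⇒∃[o]m+o≡n (ℕ.m^n>0 b k))))

  -- The largest digit c = a + b − d − 1, the interval [L, U] that (a − b)·K must meet
  -- (see digit-≥ and digit-≤), and the offset K = ⌊U / m⌋ with m = a − b.
  c U L K : ℤ
  c = + (a ℕ.+ b) - + d - + 1
  U = (+ d - + b + 1ℤ) * + A - + 2 * + d * + B + + b - 1ℤ
  L = (+ a - c - 1ℤ) * + A + + 2 * c * + B - + a + 1ℤ
  K = U /ℕ m

  private
    a-b : ∀ G E F → (1ℤ + ((1ℤ + G + E) + F)) - (1ℤ + G) ≡ 1ℤ + (E + F)
    a-b = solve-∀
    drop-one : ∀ K m → (1ℤ + K) * m - m ≡ m * K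
    drop-one = solve-∀

  a-b≡m : + a - + b ≡ + m
  a-b≡m = a-b (+ g) (+ e) (+ f)

  U-nonneg : 0ℤ ≤ U
  U-nonneg = upper-end-nonneg {+ g} {+ e} {+ f} {+ B} {+ h} 0≤ℕ 0≤ℕ 0≤ℕ 0≤ℕ 0≤ℕ 0≤ℕ A-split

  U<mA : U < + m * + A
  U<mA = upper-end<mA {+ g} {+ e} {+ f} {+ B′} {+ B} {+ h} 0≤ℕ 0≤ℕ 0≤ℕ 0≤ℕ 0≤ℕ B-split A-split

  mK≤U : + m * K ≤ U
  mK≤U = subst (_≤ U) (ℤ.*-comm K (+ m)) (ℤ.[n/ℕd]*d≤n U m)

  L≤mK : L ≤ + m * K
  L≤mK = begin
    L                        ≤⟨ interval-long {+ g} {+ e} {+ f} {+ B} {+ h} 0≤ℕ 0≤ℕ 0≤ℕ A-split ⟩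
    (1ℤ + U) - + m           ≤⟨ ℤ.+-monoˡ-≤ (- + m) (ℤ.i<j⇒suc[i]≤j (ℤ.n<s[n/ℕd]*d U m)) ⟩
    (1ℤ + K) * + m - + m     ≡⟨ drop-one K (+ m) ⟩
    + m * K                  ∎
    where open ℤ.≤-Reasoning

  K-nonneg : 0ℤ ≤ K
  K-nonneg = ℤ.0≤n⇒0≤n/ℕd U m U-nonneg

  K<A : K < + A
  K<A = ℤ.≰⇒> (λ A≤K → ℤ.<⇒≱ (ℤ.≤-<-trans mK≤U U<mA) (ℤ.*-monoˡ-≤-nonNeg (+ m) A≤K))

  open LocalCarry a b k K hiding (A)

  Alph : Alphabet
  Alph = AlphInt a b d

  digit-in-alphabet : ∀ (w : Fin (suc k) → ℤ) → SumSet Alph (w (fromℕ k)) → Alph (digit w)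
  digit-in-alphabet w (x , y , (x≥ , x≤) , (y≥ , y≤) , w≡x+y) =
    digit-≥ {+ A} {+ B} {+ a} {+ b} {+ d} {K} {digit w} {w (fromℕ k)} {+ r₀} {+ r₁}
            A>0 0≤ℕ 0≤ℕ 0≤ℕ 0≤ℕ (ℤ.+<+ (remainder<A (w ∘ Fin.suc))) (digit-identity w) w≥ (subst (_≤ U) mK≡ mK≤U) ,
    digit-≤ {+ A} {+ B} {+ a} {+ b} {c} {K} {digit w} {w (fromℕ k)} {+ r₀} {+ r₁}
            A>0 0≤ℕ 0≤ℕ 0≤ℕ (ℤ.+<+ (remainder<A (w ∘ inject₁))) 0≤ℕ (digit-identity w) w≤ (subst (L ≤_) mK≡ L≤mK)
    where
    A>0 : 0ℤ < + A
    A>0 = ℤ.+<+ (ℕ.m^n>0 a k)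
    r₀ r₁ : ℕ
    r₀ = remainder (w ∘ inject₁)
    r₁ = remainder (w ∘ Fin.suc)
    mK≡ : + m * K ≡ (+ a - + b) * K
    mK≡ = cong (_* K) (sym a-b≡m)
    w≥ : - + d - + d ≤ w (fromℕ k)
    w≥ = subst (- + d - + d ≤_) (sym w≡x+y) (ℤ.+-mono-≤ x≥ y≥)
    w≤ : w (fromℕ k) ≤ c + c
    w≤ = subst (_≤ c + c) (sym w≡x+y) (ℤ.+-mono-≤ x≤ y≤)

  Φ : (Fin (suc k) → Digit (SumSet Alph)) → Digit Alph
  Φ w = digit (proj₁ ∘ w) , digit-in-alphabet (proj₁ ∘ w) (proj₂ (w (fromℕ k)))

  φ : Seq (SumSet Alph) → Seq Alph
  φ u j = Φ (λ i → u (j + + 0 - + toℕ i))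

  φ-local : IsLocal φ (suc k)
  φ-local = k , 0 , trans (ℕ.+-comm (k ℕ.+ 0) 1) (cong suc (ℕ.+-identityʳ k)) , Φ , λ u j → refl

  private
    index-here : ∀ j → j + 0ℤ - 0ℤ ≡ j
    index-here = solve-∀
    index-previous : ∀ j t → j + 0ℤ - (1ℤ + t) ≡ (j - 1ℤ) - t
    index-previous = solve-∀
    index-current : ∀ j t → j + 0ℤ - t ≡ j - t
    index-current = solve-∀
    zero-digit : ∀ b a → 0ℤ + b * 0ℤ - a * 0ℤ ≡ 0ℤ
    zero-digit = solve-∀

  module _ (u : Seq (SumSet Alph)) (N : ℕ) (u-supported : SupportedIn u N) where
    z : ℤ → ℤ
    z j = proj₁ (u j)

    carryAt : ℤ → ℤ
    carryAt j = carry (λ i → z (j - + toℕ i))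

    φ-digit : ∀ j → proj₁ (φ u j) ≡ z j + + b * carryAt (j - 1ℤ) - + a * carryAt j
    φ-digit j = begin
      w Fin.zero + + b * carry (w ∘ Fin.suc) - + a * carry (w ∘ inject₁)
        ≡⟨ cong (λ y → w Fin.zero + + b * carry (w ∘ Fin.suc) - + a * y)
                (carry-cong λ i → cong z (trans (cong (λ t → j + + 0 - + t) (Fin.toℕ-inject₁ i)) (index-current j (+ toℕ i)))) ⟩
      w Fin.zero + + b * carry (w ∘ Fin.suc) - + a * carryAt j
        ≡⟨ cong₂ (λ x y → x + + b * y - + a * carryAt j) (cong z (index-here j)) (carry-cong λ i → cong z (index-previous j (+ toℕ i))) ⟩
      z j + + b * carryAt (j - 1ℤ) - + a * carryAt j
        ∎
      where
      open ≡-Reasoning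
      w : Fin (suc k) → ℤ
      w i = z (j + + 0 - + toℕ i)

    carry-vanishes : ∀ j → k ℕ.+ N ℕ.< ∣ j ∣ → carryAt j ≡ 0ℤ
    carry-vanishes j far =
      trans (carry-cong λ i → u-supported (j - + toℕ i) (distant j (ℕ.<⇒≤ (Fin.toℕ<n i)) far)) (carry-zero K-nonneg K<A)

    φ-supported : SupportedIn (φ u) (suc (k ℕ.+ N))
    φ-supported j far = begin
      proj₁ (φ u j)                                     ≡⟨ φ-digit j ⟩
      z j + + b * carryAt (j - 1ℤ) - + a * carryAt j    ≡⟨ cong₂ (λ x y → x + + b * y - + a * carryAt j)
                                                            (u-supported j (ℕ.≤-<-trans (ℕ.m≤n+m N (suc k)) far))
                                                            (carry-vanishes (j - 1ℤ) (distant j ℕ.≤-refl far)) ⟩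
      0ℤ + + b * 0ℤ - + a * carryAt j                   ≡⟨ cong (λ y → 0ℤ + + b * 0ℤ - + a * y) (carry-vanishes j (ℕ.<-trans (ℕ.n<1+n (k ℕ.+ N)) far)) ⟩
      0ℤ + + b * 0ℤ - + a * 0ℤ                          ≡⟨ zero-digit (+ b) (+ a) ⟩
      0ℤ                                                ∎
      where open ≡-Reasoning

    φ-preserves-value : value a b (φ u) (suc (k ℕ.+ N)) ≡ value a b u N
    φ-preserves-value = begin
      value a b (φ u) (suc (k ℕ.+ N))
        ≡⟨ windowSum-cong (suc (k ℕ.+ N)) (λ j → cong (λ x → ι x ℚ.* βpow a b j) (φ-digit j)) ⟩
      windowSum (suc (k ℕ.+ N)) (λ j → ι (z j + + b * carryAt (j - 1ℤ) - + a * carryAt j) ℚ.* βpow a b j)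
        ≡⟨ carry-preserves-value (d ℕ.+ f) g z carryAt N (k ℕ.+ N) (ℕ.m≤n+m N k) u-supported carry-vanishes ⟩
      value a b u N
        ∎
      where open ≡-Reasoning

  φ-conversion : IsDigitSetConversion a b φ
  φ-conversion u N supported = suc (k ℕ.+ N) , φ-supported u N supported , φ-preserves-value u N supported

  parallel-addition : ParallelAddition a b Alph
  parallel-addition = φ , φ-conversion , suc k , φ-local


open import Data.Nat using (_≤_; _<_; _∸_)
open import Data.Nat.Coprimality using (Coprime)
import Data.Nat.Properties as ℕ
open import Data.Product using (_,_)
open import Relation.Binary.PropositionalEquality using (refl)

-- Proposition 4.1.  Writing d = b + e and a − 1 = d + f puts us in `Construction g e f`.
proposition41 : (a b : ℕ) → Coprime a b → 1 ≤ b → b < a →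
    (d : ℕ) → b ≤ d → d ≤ a ∸ 1 →
    ParallelAddition a b (AlphInt a b d)
proposition41 _        ℕ.zero    _ ()  _  _ _   _
proposition41 ℕ.zero   (ℕ.suc g) _ _   () _ _   _
proposition41 (ℕ.suc _) (ℕ.suc g) _ _  _  d b≤d d≤a-1 with ℕ.m≤n⇒∃[o]m+o≡n b≤d
... | e , refl with ℕ.m≤n⇒∃[o]m+o≡n d≤a-1
... | f , refl = Construction.parallel-addition g e f
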